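{- (1) Let $a,b$ be non-negative integers with $\gcd(a,b)=1$, and let the first row of the Proth–Gilbreath triangle be the Fibonacci-type sequence $(x_1,x_2,x_3,\dots)$ with $x_1=a$, $x_2=b$, $x_{k+2}=x_k+x_{k+1}$ for $k\ge 1$. Then the left edge of the resulting triangle (the sequence of first entries of the successive rows), except for a finite number of entries, is the periodic sequence $1,1,0,1,1,0,\dots$. (2) If the first row of the Proth–Gilbreath triangle is $1,2,2^2,2^3,2^4,\dots$, then the left edge of the triangle contains only ones.
   Context: The Proth–Gilbreath triangle generated by a sequence $(d^{(0)}_k)_{k\ge1}$ of non-negative integers has rows $(d^{(j)}_k)_{k\ge 1}$, $j\ge 0$, defined by $d^{(j+1)}_k=|d^{(j)}_{k+1}-d^{(j)}_k|$. Its left edge is the sequence $(d^{(j)}_1)_{j\ge 0}$. -}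

module Defs where

open import Data.Nat using (ℕ; zero; suc; _+_; _^_; ∣_-_∣; _%_)
open import Data.Bool using (if_then_else_)
open import Data.Nat using (_≡ᵇ_)

-- Sequences indexed from 0: position k here corresponds to index k+1 in the paper.

row : (ℕ → ℕ) → ℕ → ℕ → ℕ
row d0 zero    k = d0 k
row d0 (suc j) k = ∣ row d0 j (suc k) - row d0 j k ∣

leftEdge : (ℕ → ℕ) → ℕ → ℕ
leftEdge d0 j = row d0 j 0

fibLike : ℕ → ℕ → ℕ → ℕ
fibLike a b zero          = a
fibLike a b (suc zero)    = b
fibLike a b (suc (suc k)) = fibLike a b k + fibLike a b (suc k)

period110 : ℕ → ℕ
period110 i = if (i % 3) ≡ᵇ 2 then 0 else 1

powersOf2 : ℕ → ℕ
powersOf2 k = 2 ^ k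

-- Along a Fibonacci-type first row each row of the triangle is the previous one shifted by
-- one place, since |x(k+2) − x(k+1)| = x(k).  The left edge therefore obeys the recurrence
-- e(j+2) = |e(j) − e(j+1)|, a subtractive Euclidean algorithm on consecutive pairs: gcd of
-- consecutive terms is invariant and the pair sum drops until two consecutive terms agree,
-- after which the edge is g, g, 0, g, g, 0, … with g the gcd of the first two terms.  For the
-- powers of two every row equals the first one, because 2^(k+1) − 2^k = 2^k.
module Submission where

open import Defs
open import Data.Nat using (ℕ; _≥_; _∸_)
open import Data.Nat.GCD using (gcd)
open import Data.Product using (_×_; ∃-syntax)
open import Relation.Binary.PropositionalEquality using (_≡_)

open import Data.Bool using (if_then_else_)
open import Data.Nat using (zero; suc; _+_; _^_; _≤_; _<_; s≤s; _≡ᵇ_; _%_; ∣_-_∣; z<s)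
open import Data.Nat.Properties
open import Data.Nat.DivMod using ([m+n]%n≡m%n)
open import Data.Nat.Divisibility
  using (_∣_; divides; divides-refl; ∣-refl; ∣-trans; ∣-antisym; ∣m∸n∣n⇒∣m; ∣m+n∣m⇒∣n)
open import Data.Nat.GCD using (gcd[m,n]∣m; gcd[m,n]∣n; gcd-greatest; gcd-universality; gcd-comm)
open import Data.Nat.Induction using (<-wellFounded)
open import Data.Product using (_,_)
open import Data.Sum using (inj₁; inj₂)
open import Induction.WellFounded using (Acc; acc)
open import Relation.Binary.PropositionalEquality using (refl; sym; trans; cong; cong₂; subst; module ≡-Reasoning)
open ≡-Reasoning

∣m+n-n∣≡m : ∀ m n → ∣ m + n - n ∣ ≡ m
∣m+n-n∣≡m m n = begin
  ∣ m + n - n ∣ ≡⟨ ∣-∣-comm (m + n) n ⟩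
  ∣ n - m + n ∣ ≡⟨ cong ∣ n -_∣ (+-comm m n) ⟩
  ∣ n - n + m ∣ ≡⟨ ∣m-m+n∣≡n n m ⟩
  m             ∎

m≤n⇒∣n-∣m-n∣∣≡m : ∀ {m n} → m ≤ n → ∣ n - ∣ m - n ∣ ∣ ≡ m
m≤n⇒∣n-∣m-n∣∣≡m {m} {n} m≤n = begin
  ∣ n - ∣ m - n ∣ ∣ ≡⟨ cong ∣ n -_∣ (m≤n⇒∣m-n∣≡n∸m m≤n) ⟩
  ∣ n - n ∸ m ∣     ≡⟨ m≤n⇒∣n-m∣≡n∸m (m∸n≤m n m) ⟩
  n ∸ (n ∸ m)       ≡⟨ m∸[m∸n]≡n m≤n ⟩
  m                 ∎

∣m∣n⇒∣∣m-n∣ : ∀ {d m n} → d ∣ m → d ∣ n → d ∣ ∣ m - n ∣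
∣m∣n⇒∣∣m-n∣ {d} (divides-refl p) (divides-refl q) = divides ∣ p - q ∣ (sym (*-distribʳ-∣-∣ d p q))

∣m∣∣n-m∣⇒∣n : ∀ {d m n} → d ∣ m → d ∣ ∣ n - m ∣ → d ∣ n
∣m∣∣n-m∣⇒∣n {d} {m} {n} d∣m d∣∣n-m∣ with ≤-total m n
... | inj₁ m≤n = ∣m∸n∣n⇒∣m d m≤n (subst (d ∣_) (m≤n⇒∣n-m∣≡n∸m m≤n) d∣∣n-m∣) d∣m
... | inj₂ n≤m = ∣m+n∣m⇒∣n (subst (d ∣_) (sym (m∸n+n≡m n≤m)) d∣m)
                           (subst (d ∣_) (m≤n⇒∣m-n∣≡n∸m n≤m) d∣∣n-m∣)

gcd[m,∣n-m∣]≡gcd[m,n] : ∀ m n → gcd m ∣ n - m ∣ ≡ gcd m n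
gcd[m,∣n-m∣]≡gcd[m,n] m n = gcd-universality
  (λ (d∣m , d∣n) → gcd-greatest d∣m (∣m∣n⇒∣∣m-n∣ d∣n d∣m))
  (λ d∣g → let d∣m = ∣-trans d∣g (gcd[m,n]∣m m ∣ n - m ∣) in
           d∣m , ∣m∣∣n-m∣⇒∣n d∣m (∣-trans d∣g (gcd[m,n]∣n m ∣ n - m ∣)))

gcd[n,n]≡n : ∀ n → gcd n n ≡ n
gcd[n,n]≡n n = ∣-antisym (gcd[m,n]∣m n n) (gcd-greatest ∣-refl ∣-refl)

diffSeq : ℕ → ℕ → ℕ → ℕ
diffSeq u v zero    = u
diffSeq u v (suc n) = diffSeq v ∣ u - v ∣ n

diffSeq-+ : ∀ u v m n → diffSeq u v (m + n) ≡ diffSeq (diffSeq u v m) (diffSeq u v (suc m)) n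
diffSeq-+ u v zero    n = refl
diffSeq-+ u v (suc m) n = diffSeq-+ v ∣ u - v ∣ m n

diffSeq-unique : (e : ℕ → ℕ) → (∀ n → e (suc (suc n)) ≡ ∣ e n - e (suc n) ∣) →
                 ∀ n → e n ≡ diffSeq (e 0) (e 1) n
diffSeq-unique e rec zero    = refl
diffSeq-unique e rec (suc n) =
  trans (diffSeq-unique (λ k → e (suc k)) (λ k → rec (suc k)) n)
        (cong (λ w → diffSeq (e 1) w n) (rec 0))

gcd-diffSeq : ∀ u v n → gcd (diffSeq u v n) (diffSeq u v (suc n)) ≡ gcd u v
gcd-diffSeq u v zero    = refl
gcd-diffSeq u v (suc n) =
  trans (gcd-diffSeq v ∣ u - v ∣ n) (trans (gcd[m,∣n-m∣]≡gcd[m,n] v u) (gcd-comm v u))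

ReachesDiagonal : ℕ → ℕ → Set
ReachesDiagonal u v = ∃[ N ] diffSeq u v N ≡ diffSeq u v (suc N)

reachesDiagonal-later : ∀ u v m →
  ReachesDiagonal (diffSeq u v m) (diffSeq u v (suc m)) → ReachesDiagonal u v
reachesDiagonal-later u v m (N , eq) = m + N , (begin
  diffSeq u v (m + N)                                   ≡⟨ diffSeq-+ u v m N ⟩
  diffSeq (diffSeq u v m) (diffSeq u v (suc m)) N       ≡⟨ eq ⟩
  diffSeq (diffSeq u v m) (diffSeq u v (suc m)) (suc N) ≡⟨ diffSeq-+ u v m (suc N) ⟨
  diffSeq u v (m + suc N)                               ≡⟨ cong (diffSeq u v) (+-suc m N) ⟩
  diffSeq u v (suc (m + N))                             ∎)

-- Well-founded on u + v: one step lowers it when v ≤ u, two steps when u < v.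
reachesDiagonal : ∀ u v → ReachesDiagonal u v
reachesDiagonal u v = go u v (<-wellFounded (u + v))
  where
  go : ∀ u v → Acc _<_ (u + v) → ReachesDiagonal u v
  go zero    v       _         = 1 , refl
  go (suc u) zero    _         = 2 , refl
  go (suc u) (suc v) (acc rec) with ≤-<-connex v u
  ... | inj₁ v≤u = reachesDiagonal-later (suc u) (suc v) 1 (go (suc v) ∣ u - v ∣ (rec smaller))
    where
    sum≡ : suc v + ∣ u - v ∣ ≡ suc u
    sum≡ = cong suc (trans (cong (v +_) (m≤n⇒∣n-m∣≡n∸m v≤u)) (m+[n∸m]≡n v≤u))
    smaller : suc v + ∣ u - v ∣ < suc u + suc v
    smaller = subst (_< suc u + suc v) (sym sum≡) (m<m+n (suc u) z<s)
  ... | inj₂ u<v = reachesDiagonal-later (suc u) (suc v) 2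
                     (subst (ReachesDiagonal ∣ u - v ∣) (sym (m≤n⇒∣n-∣m-n∣∣≡m (s≤s (<⇒≤ u<v))))
                            (go ∣ u - v ∣ (suc u) (rec smaller)))
    where
    sum≡ : ∣ u - v ∣ + suc u ≡ suc v
    sum≡ = trans (+-suc ∣ u - v ∣ u)
                 (cong suc (trans (cong (_+ u) (m≤n⇒∣m-n∣≡n∸m (<⇒≤ u<v))) (m∸n+n≡m (<⇒≤ u<v))))
    smaller : ∣ u - v ∣ + suc u < suc u + suc v
    smaller = subst (_< suc u + suc v) (sym sum≡) (m<n+m (suc v) z<s)

diffSeq-eventually-gcd : ∀ u v → ∃[ N ] (diffSeq u v N ≡ gcd u v × diffSeq u v (suc N) ≡ gcd u v)
diffSeq-eventually-gcd u v with reachesDiagonal u v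
... | N , diagonal = N , atN , trans (sym diagonal) atN
  where
  atN : diffSeq u v N ≡ gcd u v
  atN = begin
    diffSeq u v N                                ≡⟨ gcd[n,n]≡n (diffSeq u v N) ⟨
    gcd (diffSeq u v N) (diffSeq u v N)          ≡⟨ cong (gcd (diffSeq u v N)) diagonal ⟩
    gcd (diffSeq u v N) (diffSeq u v (suc N))    ≡⟨ gcd-diffSeq u v N ⟩
    gcd u v                                      ∎

period110-+3 : ∀ i → period110 (3 + i) ≡ period110 i
period110-+3 i = cong (λ r → if r ≡ᵇ 2 then 0 else 1)
                      (trans (cong (_% 3) (+-comm 3 i)) ([m+n]%n≡m%n i 3))

diffSeq-1-1 : ∀ i → diffSeq 1 1 i ≡ period110 i
diffSeq-1-1 zero                = refl
diffSeq-1-1 (suc zero)          = refl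
diffSeq-1-1 (suc (suc zero))    = refl
diffSeq-1-1 (suc (suc (suc i))) = trans (diffSeq-1-1 i) (sym (period110-+3 i))

diffSeq-coprime-eventually-period110 : ∀ u v → gcd u v ≡ 1 →
  ∃[ N ] ((j : ℕ) → j ≥ N → diffSeq u v j ≡ period110 (j ∸ N))
diffSeq-coprime-eventually-period110 u v coprime with diffSeq-eventually-gcd u v
... | N , atN , atN+1 = N , λ j j≥N → begin
  diffSeq u v j                                         ≡⟨ cong (diffSeq u v) (m+[n∸m]≡n j≥N) ⟨
  diffSeq u v (N + (j ∸ N))                             ≡⟨ diffSeq-+ u v N (j ∸ N) ⟩
  diffSeq (diffSeq u v N) (diffSeq u v (suc N)) (j ∸ N) ≡⟨ cong₂ (λ x y → diffSeq x y (j ∸ N))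
                                                                  (trans atN coprime) (trans atN+1 coprime) ⟩
  diffSeq 1 1 (j ∸ N)                                   ≡⟨ diffSeq-1-1 (j ∸ N) ⟩
  period110 (j ∸ N)                                     ∎

IsFibonacciLike : (ℕ → ℕ) → Set
IsFibonacciLike x = ∀ k → x (suc (suc k)) ≡ x k + x (suc k)

fibLike-isFibonacciLike : ∀ a b → IsFibonacciLike (fibLike a b)
fibLike-isFibonacciLike a b k = refl

row-fibonacciLike-shift : ∀ {x} → IsFibonacciLike x → ∀ j k → row x (suc j) (suc k) ≡ row x j k
row-fibonacciLike-shift {x} fib zero k =
  trans (cong ∣_- x (suc k) ∣ (fib k)) (∣m+n-n∣≡m (x k) (x (suc k)))
row-fibonacciLike-shift fib (suc j) k =
  cong₂ ∣_-_∣ (row-fibonacciLike-shift fib j (suc k)) (row-fibonacciLike-shift fib j k)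

leftEdge-fibonacciLike : ∀ {x} → IsFibonacciLike x → ∀ j → leftEdge x j ≡ diffSeq (x 0) ∣ x 1 - x 0 ∣ j
leftEdge-fibonacciLike {x} fib =
  diffSeq-unique (leftEdge x) (λ j → cong ∣_- leftEdge x (suc j) ∣ (row-fibonacciLike-shift fib j 0))

IsDoubling : (ℕ → ℕ) → Set
IsDoubling x = ∀ k → x (suc k) ≡ x k + x k

powersOf2-isDoubling : IsDoubling powersOf2
powersOf2-isDoubling k = cong (2 ^ k +_) (+-identityʳ (2 ^ k))

row-doubling : ∀ {x} → IsDoubling x → ∀ j k → row x j k ≡ x k
row-doubling dbl zero k = refl
row-doubling {x} dbl (suc j) k = begin
  ∣ row x j (suc k) - row x j k ∣ ≡⟨ cong₂ ∣_-_∣ (row-doubling dbl j (suc k)) (row-doubling dbl j k) ⟩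
  ∣ x (suc k) - x k ∣             ≡⟨ cong ∣_- x k ∣ (dbl k) ⟩
  ∣ x k + x k - x k ∣             ≡⟨ ∣m+n-n∣≡m (x k) (x k) ⟩
  x k                             ∎

proposition1 : ((a b : ℕ) → gcd a b ≡ 1 →
    ∃[ N ] ((j : ℕ) → j ≥ N → leftEdge (fibLike a b) j ≡ period110 (j ∸ N)))
    × ((j : ℕ) → leftEdge powersOf2 j ≡ 1)
proposition1 = fibonacciEdge , λ j → row-doubling powersOf2-isDoubling j 0
  where
  fibonacciEdge : (a b : ℕ) → gcd a b ≡ 1 →
    ∃[ N ] ((j : ℕ) → j ≥ N → leftEdge (fibLike a b) j ≡ period110 (j ∸ N))
  fibonacciEdge a b coprime
    with diffSeq-coprime-eventually-period110 a ∣ b - a ∣ (trans (gcd[m,∣n-m∣]≡gcd[m,n] a b) coprime)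
  ... | N , periodic =
    N , λ j j≥N → trans (leftEdge-fibonacciLike (fibLike-isFibonacciLike a b) j) (periodic j j≥N)
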